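{- Let $b\ne c$ be non-zero complex numbers and let $$G(x)=\frac{8}{(b-c)^2}\cdot\frac{1-\frac{b+c}{2}x-\sqrt{(1-bx)(1-cx)}}{x^2},$$ where $\sqrt{(1-bx)(1-cx)}$ is the formal power series square root with constant term $1$ (so $G$ is a formal power series). Then for all $d\in\mathbb{N}$, the matrix $(H[G])^{(d,d)}$ has full rank.
   Context: Indices start at $0$, $\mathbb{N}=\{0,1,2,\dots\}$. For a formal power series $h=\sum_kh_kx^k$, $H[h]$ is the Hankel matrix with entries $H_{i,j}=h_{i+j}$, and $(H[h])^{(d,d)}$ is its $(d+1)\times(d+1)$ top-left submatrix (rows and columns $0,\dots,d$). -}

module Defs where

open import Level using (Level; _⊔_) renaming (suc to lsuc)
open import Data.Nat using (ℕ; zero; suc; _∸_) renaming (_+_ to _ℕ+_)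
open import Data.Product using (_×_)
open import Data.Fin using (Fin; toℕ) renaming (zero to fzero; suc to fsuc)
open import Relation.Nullary using (¬_)
open import Algebra.Bundles using (CommutativeRing)

-- A field: a commutative ring with 1 ≉ 0 and a (total) inverse operation
-- that is a genuine inverse on non-zero elements (value at 0 irrelevant).
record Field (c ℓ : Level) : Set (lsuc (c ⊔ ℓ)) where
  field
    commutativeRing : CommutativeRing c ℓ
  open CommutativeRing commutativeRing public
  field
    _⁻¹       : Carrier → Carrier
    ⁻¹-cong   : ∀ {x y} → x ≈ y → x ⁻¹ ≈ y ⁻¹
    ⁻¹-inverse : ∀ x → ¬ (x ≈ 0#) → x * (x ⁻¹) ≈ 1#
    1≉0       : ¬ (1# ≈ 0#)

module _ {c ℓ : Level} (F : Field c ℓ) where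
  open Field F using (Carrier; _≈_; _+_; _*_; -_; _-_; 0#; 1#; _⁻¹)

  fromℕ : ℕ → Carrier
  fromℕ zero    = 0#
  fromℕ (suc n) = 1# + fromℕ n

  CharZero : Set ℓ
  CharZero = ∀ n → ¬ (fromℕ (suc n) ≈ 0#)

  sumFin : (n : ℕ) → (Fin n → Carrier) → Carrier
  sumFin zero    f = 0#
  sumFin (suc n) f = f fzero + sumFin n (λ i → f (fsuc i))

  Series : Set c
  Series = ℕ → Carrier

  _⊛_ : Series → Series → Series
  (f ⊛ g) n = sumFin (suc n) (λ i → f (toℕ i) * g (n ∸ toℕ i))

  _≈ˢ_ : Series → Series → Set ℓ
  f ≈ˢ g = ∀ n → f n ≈ g n

  -- the polynomial (1 - b x)(1 - c x) = 1 - (b + c) x + b c x²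
  P : Carrier → Carrier → Series
  P b c' zero                = 1#
  P b c' (suc zero)          = - (b + c')
  P b c' (suc (suc zero))    = b * c'
  P b c' (suc (suc (suc n))) = 0#

  IsSqrtP : Carrier → Carrier → Series → Set ℓ
  IsSqrtP b c' s = (s 0 ≈ 1#) × ((s ⊛ s) ≈ˢ P b c')


  numer : Carrier → Carrier → Series → Series
  numer b c' s zero             = 1# - s zero
  numer b c' s (suc zero)       = - ((fromℕ 2 ⁻¹) * (b + c')) - s 1
  numer b c' s (suc (suc n))    = - s (suc (suc n))

  -- G(x) = 8/(b-c)² · numer(x) / x²  (division by x² = shift of coefficients by 2)
  G : Carrier → Carrier → Series → Series
  G b c' s k = (fromℕ 8 * (((b - c') * (b - c')) ⁻¹)) * numer b c' s (suc (suc k))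

  -- (H[h])^{(d,d)}: the (d+1)×(d+1) top-left Hankel submatrix, entries h_{i+j}
  hankel : (d : ℕ) → Series → Fin (suc d) → Fin (suc d) → Carrier
  hankel d h i j = h (toℕ i ℕ+ toℕ j)


  -- a square n×n matrix has full rank: its kernel is trivial
  FullRank : (n : ℕ) → (Fin n → Fin n → Carrier) → Set (c ⊔ ℓ)
  FullRank n M = (v : Fin n → Carrier) →
                 (∀ i → sumFin n (λ j → M i j * v j) ≈ 0#) →
                 ∀ j → v j ≈ 0#

module Submission where

open import Defs using (Field; CharZero; Series; IsSqrtP; FullRank; hankel; G)
import Defs

open import Algebra.Bundles using (CommutativeRing; CommutativeSemiring)
import Algebra.Solver.Ring.AlmostCommutativeRing as ACR
open import Data.Fin.Base as Fin using (Fin; toℕ)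
import Data.Fin.Properties as Fin
open import Data.Fin.Induction using (<-wellFounded; >-wellFounded)
open import Data.Integer.Base as ℤ using (ℤ; +_; -[1+_]; _⊖_)
import Data.Integer.Properties as ℤ
open import Data.Maybe.Base using (Maybe; just; nothing)
open import Data.Nat.Base as ℕ using (ℕ; zero; suc; z≤n; z<s; s<s; _<_)
import Data.Nat.Properties as ℕ
open import Data.Product.Base using (proj₁; proj₂)
open import Data.Sum.Base using (_⊎_; inj₁; inj₂)
open import Data.Vec.Functional using (Vector)
open import Function.Base using (_∘_)
open import Induction.WellFounded using (WellFounded; Acc; acc)
open import Relation.Binary.Core using (Rel)
open import Relation.Binary.Definitions using (tri<; tri≈; tri>)
open import Relation.Binary.PropositionalEquality as ≡ using (_≡_; _≢_)
open import Relation.Nullary using (¬_; yes; no; contradiction)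

-- Write s = 1 + s₁x + x²σ. Comparing coefficients in s² = (1 − bx)(1 − cx) gives 2s₁ = −(b + c)
-- and −8σ₀ = (b − c)², and shows that G = −8σ/(b − c)² satisfies G(0) = 1 and
-- G = 1 + αxG + βx²G² with α = (b + c)/2 and β = (b − c)²/16 ≠ 0.
-- For any such G the series x^k G^(k+1) are the columns of a lower unitriangular matrix L whose
-- rows obey the recurrence of the tridiagonal Jacobi matrix with entries 1, α, β. That matrix is
-- symmetric for the weights β^k, which gives H[G] = L diag(β^k) Lᵀ on every leading principal
-- submatrix; a product of unitriangular and invertible diagonal matrices has trivial kernel.

module IntegerCoefficients {c ℓ} (R : CommutativeRing c ℓ) where
  open CommutativeRing R
  open import Algebra.Properties.Semiring.Mult.TCOptimised semiring
  open import Algebra.Properties.Ring ring using (-‿+-comm; -‿involutive; -‿distribˡ-*; -0#≈0#)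
  open import Algebra.Properties.AbelianGroup +-abelianGroup using (xyx⁻¹≈y)
  open import Relation.Binary.Reasoning.Setoid setoid

  ⟦_⟧ℤ : ℤ → Carrier
  ⟦ + n ⟧ℤ      = n × 1#
  ⟦ -[1+ n ] ⟧ℤ = - (suc n × 1#)

  private
    [a+x]-[a+y]≈x-y : ∀ a x y → (a + x) - (a + y) ≈ x - y
    [a+x]-[a+y]≈x-y a x y = begin
      (a + x) - (a + y)       ≈⟨ +-congˡ (-‿cong (+-comm a y)) ⟩
      (a + x) - (y + a)       ≈⟨ +-congˡ (-‿+-comm y a) ⟨
      (a + x) + (- y + - a)   ≈⟨ +-assoc _ _ _ ⟨
      ((a + x) - y) + - a     ≈⟨ +-congʳ (+-assoc a x (- y)) ⟩
      (a + (x - y)) + - a     ≈⟨ xyx⁻¹≈y a (x - y) ⟩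
      x - y                   ∎

  ⟦⊖⟧ℤ : ∀ m n → ⟦ m ⊖ n ⟧ℤ ≈ m × 1# - n × 1#
  ⟦⊖⟧ℤ m       zero    rewrite ℤ.⊖-≥ (z≤n {m}) = sym (trans (+-congˡ -0#≈0#) (+-identityʳ _))
  ⟦⊖⟧ℤ zero    (suc n) rewrite ℤ.⊖-< (z<s {n}) = sym (+-identityˡ _)
  ⟦⊖⟧ℤ (suc m) (suc n) rewrite ℤ.[1+m]⊖[1+n]≡m⊖n m n = begin
    ⟦ m ⊖ n ⟧ℤ                             ≈⟨ ⟦⊖⟧ℤ m n ⟩
    m × 1# - n × 1#                        ≈⟨ [a+x]-[a+y]≈x-y 1# _ _ ⟨
    (1# + m × 1#) - (1# + n × 1#)          ≈⟨ +-cong (1+× m 1#) (-‿cong (1+× n 1#)) ⟨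
    suc m × 1# - suc n × 1#                ∎

  ⟦-⟧ℤ : ∀ i → ⟦ ℤ.- i ⟧ℤ ≈ - ⟦ i ⟧ℤ
  ⟦-⟧ℤ (+ zero)  = sym -0#≈0#
  ⟦-⟧ℤ (+ suc n) = refl
  ⟦-⟧ℤ -[1+ n ]  = sym (-‿involutive _)

  ⟦+⟧ℤ : ∀ i j → ⟦ i ℤ.+ j ⟧ℤ ≈ ⟦ i ⟧ℤ + ⟦ j ⟧ℤ
  ⟦+⟧ℤ (+ m)    (+ n)    = ×-homo-+ 1# m n
  ⟦+⟧ℤ (+ m)    -[1+ n ] = ⟦⊖⟧ℤ m (suc n)
  ⟦+⟧ℤ -[1+ m ] (+ n)    = trans (⟦⊖⟧ℤ n (suc m)) (+-comm _ _)
  ⟦+⟧ℤ -[1+ m ] -[1+ n ] = begin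
    - (suc (suc (m ℕ.+ n)) × 1#)        ≡⟨ ≡.cong (λ k → - (suc k × 1#)) (ℕ.+-suc m n) ⟨
    - ((suc m ℕ.+ suc n) × 1#)          ≈⟨ -‿cong (×-homo-+ 1# (suc m) (suc n)) ⟩
    - (suc m × 1# + suc n × 1#)         ≈⟨ -‿+-comm _ _ ⟨
    - (suc m × 1#) + - (suc n × 1#)     ∎

  ⟦+*⟧ℤ : ∀ m j → ⟦ + m ℤ.* j ⟧ℤ ≈ m × 1# * ⟦ j ⟧ℤ
  ⟦+*⟧ℤ zero    j = sym (zeroˡ _)
  ⟦+*⟧ℤ (suc m) j = begin
    ⟦ + suc m ℤ.* j ⟧ℤ                  ≡⟨ ≡.cong ⟦_⟧ℤ (ℤ.suc-* (+ m) j) ⟩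
    ⟦ j ℤ.+ + m ℤ.* j ⟧ℤ                ≈⟨ trans (⟦+⟧ℤ j (+ m ℤ.* j)) (+-congˡ (⟦+*⟧ℤ m j)) ⟩
    ⟦ j ⟧ℤ + m × 1# * ⟦ j ⟧ℤ            ≈⟨ +-congʳ (*-identityˡ _) ⟨
    1# * ⟦ j ⟧ℤ + m × 1# * ⟦ j ⟧ℤ       ≈⟨ distribʳ _ _ _ ⟨
    (1# + m × 1#) * ⟦ j ⟧ℤ              ≈⟨ *-congʳ (1+× m 1#) ⟨
    suc m × 1# * ⟦ j ⟧ℤ                 ∎

  ⟦*⟧ℤ : ∀ i j → ⟦ i ℤ.* j ⟧ℤ ≈ ⟦ i ⟧ℤ * ⟦ j ⟧ℤ
  ⟦*⟧ℤ (+ m)    j = ⟦+*⟧ℤ m j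
  ⟦*⟧ℤ -[1+ m ] j = begin
    ⟦ -[1+ m ] ℤ.* j ⟧ℤ                 ≡⟨ ≡.cong ⟦_⟧ℤ (ℤ.neg-distribˡ-* (+ suc m) j) ⟨
    ⟦ ℤ.- (+ suc m ℤ.* j) ⟧ℤ            ≈⟨ trans (⟦-⟧ℤ (+ suc m ℤ.* j)) (-‿cong (⟦+*⟧ℤ (suc m) j)) ⟩
    - (suc m × 1# * ⟦ j ⟧ℤ)             ≈⟨ -‿distribˡ-* _ _ ⟩
    - (suc m × 1#) * ⟦ j ⟧ℤ             ∎

  private
    ℤ⟶R : ℤ.+-*-rawRing ACR.-Raw-AlmostCommutative⟶ ACR.fromCommutativeRing R
    ℤ⟶R = record
      { ⟦_⟧ = ⟦_⟧ℤ ; +-homo = ⟦+⟧ℤ ; *-homo = ⟦*⟧ℤ ; -‿homo = ⟦-⟧ℤ ; 0-homo = refl ; 1-homo = refl }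

    ⟦⟧ℤ-≟ : ∀ i j → Maybe (⟦ i ⟧ℤ ≈ ⟦ j ⟧ℤ)
    ⟦⟧ℤ-≟ i j with i ℤ.≟ j
    ... | yes ≡.refl = just refl
    ... | no _       = nothing

  open import Algebra.Solver.Ring ℤ.+-*-rawRing (ACR.fromCommutativeRing R) ℤ⟶R ⟦⟧ℤ-≟ public

  -- Since 1 × x = x for the optimised _×_, con (+ 1) and con (+ 0) evaluate to 1# and 0#, so
  -- lit n evaluates to 1# + (1# + ⋯ + (1# + 0#)), which is exactly the normal form of Defs.fromℕ n.
  lit : ∀ {m} → ℕ → Polynomial m
  lit zero    = con (+ 0)
  lit (suc n) = con (+ 1) :+ lit n

module FieldProperties {c ℓ} (F : Field c ℓ) where
  open Field F
  open import Algebra.Properties.Semiring.Exp semiring using (_^_)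
  open import Relation.Binary.Reasoning.Setoid setoid

  ⁻¹-inverseˡ : ∀ {x} → ¬ x ≈ 0# → x ⁻¹ * x ≈ 1#
  ⁻¹-inverseˡ {x} x≉0 = trans (*-comm (x ⁻¹) x) (⁻¹-inverse x x≉0)

  x*y≈0⇒y≈0 : ∀ {x y} → ¬ x ≈ 0# → x * y ≈ 0# → y ≈ 0#
  x*y≈0⇒y≈0 {x} {y} x≉0 xy≈0 = begin
    y                ≈⟨ *-identityˡ y ⟨
    1# * y           ≈⟨ *-congʳ (⁻¹-inverseˡ x≉0) ⟨
    (x ⁻¹ * x) * y   ≈⟨ *-assoc _ _ _ ⟩
    x ⁻¹ * (x * y)   ≈⟨ *-congˡ xy≈0 ⟩
    x ⁻¹ * 0#        ≈⟨ zeroʳ _ ⟩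
    0#               ∎

  *-≉0 : ∀ {x y} → ¬ x ≈ 0# → ¬ y ≈ 0# → ¬ x * y ≈ 0#
  *-≉0 x≉0 y≉0 xy≈0 = y≉0 (x*y≈0⇒y≈0 x≉0 xy≈0)

  ⁻¹-≉0 : ∀ {x} → ¬ x ≈ 0# → ¬ x ⁻¹ ≈ 0#
  ⁻¹-≉0 {x} x≉0 x⁻¹≈0 = 1≉0 (begin
    1#          ≈⟨ ⁻¹-inverse x x≉0 ⟨
    x * x ⁻¹    ≈⟨ *-congˡ x⁻¹≈0 ⟩
    x * 0#      ≈⟨ zeroʳ x ⟩
    0#          ∎)

  ^-≉0 : ∀ {x} → ¬ x ≈ 0# → ∀ k → ¬ x ^ k ≈ 0#
  ^-≉0 x≉0 zero    = 1≉0
  ^-≉0 x≉0 (suc k) = *-≉0 x≉0 (^-≉0 x≉0 k)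

  q*x≈q*y+z⇒x≈y+q⁻¹*z : ∀ {q x y z} → ¬ q ≈ 0# → q * x ≈ q * y + z → x ≈ y + q ⁻¹ * z
  q*x≈q*y+z⇒x≈y+q⁻¹*z {q} {x} {y} {z} q≉0 eq = begin
    x                           ≈⟨ q⁻¹*[q*w]≈w x ⟨
    q ⁻¹ * (q * x)              ≈⟨ *-congˡ eq ⟩
    q ⁻¹ * (q * y + z)          ≈⟨ distribˡ _ _ _ ⟩
    q ⁻¹ * (q * y) + q ⁻¹ * z   ≈⟨ +-congʳ (q⁻¹*[q*w]≈w y) ⟩
    y + q ⁻¹ * z                ∎
    where
    q⁻¹*[q*w]≈w : ∀ w → q ⁻¹ * (q * w) ≈ w
    q⁻¹*[q*w]≈w w = begin
      q ⁻¹ * (q * w)   ≈⟨ *-assoc _ _ _ ⟨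
      (q ⁻¹ * q) * w   ≈⟨ *-congʳ (⁻¹-inverseˡ q≉0) ⟩
      1# * w           ≈⟨ *-identityˡ w ⟩
      w                ∎

module FiniteSums {c ℓ} (R : CommutativeSemiring c ℓ) where
  open CommutativeSemiring R
  open import Algebra.Properties.Semiring.Sum semiring
  open import Relation.Binary.Reasoning.Setoid setoid

  sum-zero : ∀ {n} {f : Vector Carrier n} → (∀ k → f k ≈ 0#) → sum f ≈ 0#
  sum-zero {n} f≈0 = trans (sum-cong-≋ f≈0) (sum-replicate-zero n)

  sum-single : ∀ {n} (f : Vector Carrier n) i → (∀ k → k ≢ i → f k ≈ 0#) → sum f ≈ f i
  sum-single f Fin.zero    f≈0 =
    trans (+-congˡ (sum-zero (λ k → f≈0 (Fin.suc k) (λ ())))) (+-identityʳ _)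
  sum-single f (Fin.suc i) f≈0 =
    trans (+-congʳ (f≈0 Fin.zero (λ ())))
          (trans (+-identityˡ _)
                 (sum-single (f ∘ Fin.suc) i (λ k k≢i → f≈0 (Fin.suc k) (k≢i ∘ Fin.suc-injective))))

  sum-snoc : ∀ n (f : ℕ → Carrier) → ∑[ k < suc n ] f (toℕ k) ≈ ∑[ k < n ] f (toℕ k) + f n
  sum-snoc zero    f = trans (+-identityʳ _) (sym (+-identityˡ _))
  sum-snoc (suc n) f = trans (+-congˡ (sum-snoc n (f ∘ suc))) (sym (+-assoc _ _ _))

  sum-shift : ∀ n (a b : ℕ → Carrier) → a 0 ≈ 0# → b n ≈ 0# → (∀ k → a (suc k) ≈ b k) →
              ∑[ k < suc n ] a (toℕ k) ≈ ∑[ k < suc n ] b (toℕ k)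
  sum-shift n a b a₀≈0 bₙ≈0 a[1+k]≈bₖ = begin
    a 0 + ∑[ k < n ] a (suc (toℕ k))   ≈⟨ +-cong a₀≈0 (sum-cong-≋ {n} (a[1+k]≈bₖ ∘ toℕ)) ⟩
    0# + ∑[ k < n ] b (toℕ k)           ≈⟨ +-identityˡ _ ⟩
    ∑[ k < n ] b (toℕ k)                ≈⟨ +-identityʳ _ ⟨
    ∑[ k < n ] b (toℕ k) + 0#           ≈⟨ +-congˡ bₙ≈0 ⟨
    ∑[ k < n ] b (toℕ k) + b n          ≈⟨ sum-snoc n b ⟨
    ∑[ k < suc n ] b (toℕ k)            ∎

  ∑-linear : ∀ {n} (a b c : Vector Carrier n) x →
             ∑[ k < n ] ((a k + b k) + x * c k) ≈ (sum a + sum b) + x * sum c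
  ∑-linear a b c x = trans (∑-distrib-+ (λ k → a k + b k) (λ k → x * c k))
                           (+-cong (∑-distrib-+ a b) (sym (*-distribˡ-sum x c)))

  ∑-reassoc : ∀ {m n} (a : Vector Carrier m) (B : Fin m → Fin n → Carrier) (v : Vector Carrier n) →
              ∑[ j < n ] (∑[ k < m ] (a k * B k j) * v j) ≈ ∑[ k < m ] (a k * ∑[ j < n ] (B k j * v j))
  ∑-reassoc {m} {n} a B v = begin
    ∑[ j < n ] (∑[ k < m ] (a k * B k j) * v j)
      ≈⟨ sum-cong-≋ (λ j → *-distribʳ-sum (v j) (λ k → a k * B k j)) ⟩
    ∑[ j < n ] ∑[ k < m ] ((a k * B k j) * v j)
      ≈⟨ ∑-comm (λ j k → (a k * B k j) * v j) ⟩
    ∑[ k < m ] ∑[ j < n ] ((a k * B k j) * v j)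
      ≈⟨ sum-cong-≋ (λ k → sum-cong-≋ (λ j → *-assoc (a k) (B k j) (v j))) ⟩
    ∑[ k < m ] ∑[ j < n ] (a k * (B k j * v j))
      ≈⟨ sum-cong-≋ (λ k → *-distribˡ-sum (a k) (λ j → B k j * v j)) ⟨
    ∑[ k < m ] (a k * ∑[ j < n ] (B k j * v j))
      ∎

  module _ {n} (A : Fin n → Fin n → Carrier) (A-diagonal : ∀ i → A i i ≈ 1#)
           {v : Vector Carrier n} (Av≈0 : ∀ i → ∑[ k < n ] (A i k * v k) ≈ 0#) where

    private
      triangular-trivialKernel : ∀ {r} {_≺_ : Rel (Fin n) r} → WellFounded _≺_ →
                                 (∀ {i k} → k ≢ i → k ≺ i ⊎ A i k ≈ 0#) → ∀ i → v i ≈ 0#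
      triangular-trivialKernel {_≺_ = _≺_} wf offDiagonal i = vᵢ≈0 (wf i)
        where
        vᵢ≈0 : ∀ {i} → Acc _≺_ i → v i ≈ 0#
        vᵢ≈0 {i} (acc earlier) = begin
          v i                        ≈⟨ *-identityˡ (v i) ⟨
          1# * v i                   ≈⟨ *-congʳ (A-diagonal i) ⟨
          A i i * v i                ≈⟨ sum-single _ i vanishes ⟨
          ∑[ k < n ] (A i k * v k)   ≈⟨ Av≈0 i ⟩
          0#                         ∎
          where
          vanishes : ∀ k → k ≢ i → A i k * v k ≈ 0#
          vanishes k k≢i with offDiagonal k≢i
          ... | inj₁ k≺i   = trans (*-congˡ (vᵢ≈0 (earlier k≺i))) (zeroʳ _)
          ... | inj₂ Aᵢₖ≈0 = trans (*-congʳ Aᵢₖ≈0) (zeroˡ _)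

    lowerUnitriangular-trivialKernel : (∀ {i k} → i Fin.< k → A i k ≈ 0#) → ∀ i → v i ≈ 0#
    lowerUnitriangular-trivialKernel A-upper≈0 = triangular-trivialKernel <-wellFounded offDiagonal
      where
      offDiagonal : ∀ {i k} → k ≢ i → k Fin.< i ⊎ A i k ≈ 0#
      offDiagonal {i} {k} k≢i with Fin.<-cmp k i
      ... | tri< k<i _ _ = inj₁ k<i
      ... | tri≈ _ k≡i _ = contradiction k≡i k≢i
      ... | tri> _ _ i<k = inj₂ (A-upper≈0 i<k)

    upperUnitriangular-trivialKernel : (∀ {i k} → k Fin.< i → A i k ≈ 0#) → ∀ i → v i ≈ 0#
    upperUnitriangular-trivialKernel A-lower≈0 = triangular-trivialKernel >-wellFounded offDiagonal
      where
      offDiagonal : ∀ {i k} → k ≢ i → i Fin.< k ⊎ A i k ≈ 0#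
      offDiagonal {i} {k} k≢i with Fin.<-cmp k i
      ... | tri< k<i _ _ = inj₂ (A-lower≈0 k<i)
      ... | tri≈ _ k≡i _ = contradiction k≡i k≢i
      ... | tri> _ _ i<k = inj₁ i<k

module LDLᵀ {c ℓ} (F : Field c ℓ) where
  open Field F
  open FieldProperties F
  open FiniteSums commutativeSemiring
  open import Algebra.Properties.Semiring.Sum semiring using (sum; sum-syntax; sum-cong-≋; *-distribˡ-sum)
  open import Relation.Binary.Reasoning.Setoid setoid

  sumFin≡sum : ∀ n (f : Vector Carrier n) → Defs.sumFin F n f ≡ sum f
  sumFin≡sum zero    f = ≡.refl
  sumFin≡sum (suc n) f = ≡.cong (λ s → f Fin.zero + s) (sumFin≡sum n (f ∘ Fin.suc))

  LDLᵀ-fullRank : ∀ {n} (H L : Fin n → Fin n → Carrier) (D : Vector Carrier n) →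
                  (∀ i → L i i ≈ 1#) → (∀ {i k} → i Fin.< k → L i k ≈ 0#) → (∀ k → ¬ D k ≈ 0#) →
                  (∀ i j → H i j ≈ ∑[ k < n ] (L i k * (D k * L j k))) →
                  FullRank F n H
  LDLᵀ-fullRank {n} H L D L-diagonal L-upper≈0 D≉0 H≈LDLᵀ v Hv≈0 =
    upperUnitriangular-trivialKernel (λ k j → L j k) L-diagonal Lᵀv≈0 L-upper≈0
    where
    Lᵀv : Vector Carrier n
    Lᵀv k = ∑[ j < n ] (L j k * v j)

    LDLᵀv≈0 : ∀ i → ∑[ k < n ] (L i k * (D k * Lᵀv k)) ≈ 0#
    LDLᵀv≈0 i = begin
      ∑[ k < n ] (L i k * (D k * Lᵀv k))                    ≈⟨ sum-cong-≋ {n} (λ k → *-congˡ (pull-D k)) ⟨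
      ∑[ k < n ] (L i k * ∑[ j < n ] ((D k * L j k) * v j))  ≈⟨ ∑-reassoc (L i) (λ k j → D k * L j k) v ⟨
      ∑[ j < n ] (∑[ k < n ] (L i k * (D k * L j k)) * v j)  ≈⟨ sum-cong-≋ {n} (λ j → *-congʳ (H≈LDLᵀ i j)) ⟨
      ∑[ j < n ] (H i j * v j)                               ≡⟨ sumFin≡sum n _ ⟨
      Defs.sumFin F n (λ j → H i j * v j)                    ≈⟨ Hv≈0 i ⟩
      0#                                                     ∎
      where
      pull-D : ∀ k → ∑[ j < n ] ((D k * L j k) * v j) ≈ D k * Lᵀv k
      pull-D k = trans (sum-cong-≋ {n} (λ j → *-assoc (D k) (L j k) (v j)))
                       (sym (*-distribˡ-sum (D k) (λ j → L j k * v j)))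

    Lᵀv≈0 : ∀ k → ∑[ j < n ] (L j k * v j) ≈ 0#
    Lᵀv≈0 k = x*y≈0⇒y≈0 (D≉0 k) (lowerUnitriangular-trivialKernel L L-diagonal LDLᵀv≈0 L-upper≈0 k)

module PowerSeries {c ℓ} (F : Field c ℓ) where
  open Field F
  open IntegerCoefficients commutativeRing
  open FiniteSums commutativeSemiring
  open import Algebra.Properties.Semiring.Sum semiring using (sum-syntax; sum-cong-≋)
  open import Algebra.Properties.Semiring.Exp semiring using (_^_)
  open import Relation.Binary.Reasoning.Setoid setoid

  infixr 7 _·ˢ_
  infixl 7 _⊛_
  infixl 6 _+ˢ_
  infix  4 _≈ˢ_ x^_∣_

  _⊛_ : Series F → Series F → Series F
  _⊛_ = Defs._⊛_ F

  _≈ˢ_ : Series F → Series F → Set ℓ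
  _≈ˢ_ = Defs._≈ˢ_ F

  tail : Series F → Series F
  tail f n = f (suc n)

  x* : Series F → Series F
  x* f zero    = 0#
  x* f (suc n) = f n

  _+ˢ_ : Series F → Series F → Series F
  (f +ˢ g) n = f n + g n

  _·ˢ_ : Carrier → Series F → Series F
  (a ·ˢ f) n = a * f n

  x*-cong : ∀ {f g} → f ≈ˢ g → x* f ≈ˢ x* g
  x*-cong f≈g zero    = refl
  x*-cong f≈g (suc n) = f≈g n

  x*-+ˢ : ∀ f g → x* (f +ˢ g) ≈ˢ x* f +ˢ x* g
  x*-+ˢ f g zero    = sym (+-identityˡ 0#)
  x*-+ˢ f g (suc n) = refl

  x*-·ˢ : ∀ a f → x* (a ·ˢ f) ≈ˢ a ·ˢ x* f
  x*-·ˢ a f zero    = sym (zeroʳ a)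
  x*-·ˢ a f (suc n) = refl

  ⊛-cong : ∀ {f f′ g g′} → f ≈ˢ f′ → g ≈ˢ g′ → f ⊛ g ≈ˢ f′ ⊛ g′
  ⊛-cong f≈f′ g≈g′ zero    = +-congʳ (*-cong (f≈f′ 0) (g≈g′ 0))
  ⊛-cong {f} {f′} f≈f′ g≈g′ (suc n) =
    +-cong (*-cong (f≈f′ 0) (g≈g′ (suc n))) (⊛-cong {tail f} {tail f′} (f≈f′ ∘ suc) g≈g′ n)

  ⊛-tailˡ : ∀ f g → f ⊛ g ≈ˢ f 0 ·ˢ g +ˢ x* (tail f ⊛ g)
  ⊛-tailˡ f g zero    = refl
  ⊛-tailˡ f g (suc n) = refl

  ⊛-tailʳ : ∀ f g → f ⊛ g ≈ˢ g 0 ·ˢ f +ˢ x* (f ⊛ tail g)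
  ⊛-tailʳ f g zero    = +-congʳ (*-comm (f 0) (g 0))
  ⊛-tailʳ f g (suc n) = begin
    f 0 * g (suc n) + (tail f ⊛ g) n                                ≈⟨ +-congˡ (⊛-tailʳ (tail f) g n) ⟩
    f 0 * g (suc n) + (g 0 * f (suc n) + x* (tail f ⊛ tail g) n)    ≈⟨ solve 3 (λ x y z → x :+ (y :+ z) := y :+ (x :+ z)) refl _ _ _ ⟩
    g 0 * f (suc n) + (f 0 * g (suc n) + x* (tail f ⊛ tail g) n)    ≈⟨ +-congˡ (⊛-tailˡ f (tail g) n) ⟨
    g 0 * f (suc n) + (f ⊛ tail g) n                                ∎

  ⊛-distribʳ-+ˢ : ∀ f f′ h → (f +ˢ f′) ⊛ h ≈ˢ f ⊛ h +ˢ f′ ⊛ h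
  ⊛-distribʳ-+ˢ f f′ h zero    =
    solve 3 (λ x x′ y → (x :+ x′) :* y :+ con (+ 0) := (x :* y :+ con (+ 0)) :+ (x′ :* y :+ con (+ 0)))
            refl (f 0) (f′ 0) (h 0)
  ⊛-distribʳ-+ˢ f f′ h (suc n) = begin
    (f 0 + f′ 0) * h (suc n) + ((tail f +ˢ tail f′) ⊛ h) n
      ≈⟨ +-congˡ (⊛-distribʳ-+ˢ (tail f) (tail f′) h n) ⟩
    (f 0 + f′ 0) * h (suc n) + ((tail f ⊛ h) n + (tail f′ ⊛ h) n)
      ≈⟨ solve 5 (λ x x′ y p p′ → (x :+ x′) :* y :+ (p :+ p′) := (x :* y :+ p) :+ (x′ :* y :+ p′)) refl _ _ _ _ _ ⟩
    (f 0 * h (suc n) + (tail f ⊛ h) n) + (f′ 0 * h (suc n) + (tail f′ ⊛ h) n)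
      ∎

  ·ˢ-⊛ : ∀ a f h → (a ·ˢ f) ⊛ h ≈ˢ a ·ˢ (f ⊛ h)
  ·ˢ-⊛ a f h zero    = solve 3 (λ a x y → a :* x :* y :+ con (+ 0) := a :* (x :* y :+ con (+ 0))) refl a (f 0) (h 0)
  ·ˢ-⊛ a f h (suc n) = trans (+-congˡ (·ˢ-⊛ a (tail f) h n))
    (solve 4 (λ a x y p → a :* x :* y :+ a :* p := a :* (x :* y :+ p)) refl a (f 0) (h (suc n)) _)

  ⊛-·ˢ : ∀ a f h → f ⊛ (a ·ˢ h) ≈ˢ a ·ˢ (f ⊛ h)
  ⊛-·ˢ a f h zero    = solve 3 (λ a x y → x :* (a :* y) :+ con (+ 0) := a :* (x :* y :+ con (+ 0))) refl a (f 0) (h 0)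
  ⊛-·ˢ a f h (suc n) = trans (+-congˡ (⊛-·ˢ a (tail f) h n))
    (solve 4 (λ a x y p → x :* (a :* y) :+ a :* p := a :* (x :* y :+ p)) refl a (f 0) (h (suc n)) _)

  x*-⊛ : ∀ f g → (x* f) ⊛ g ≈ˢ x* (f ⊛ g)
  x*-⊛ f g zero    = solve 1 (λ y → con (+ 0) :* y :+ con (+ 0) := con (+ 0)) refl (g 0)
  x*-⊛ f g (suc n) = solve 2 (λ y p → con (+ 0) :* y :+ p := p) refl (g (suc n)) _

  ⊛-x* : ∀ f g → f ⊛ (x* g) ≈ˢ x* (f ⊛ g)
  ⊛-x* f g zero    = solve 1 (λ x → x :* con (+ 0) :+ con (+ 0) := con (+ 0)) refl (f 0)
  ⊛-x* f g (suc n) = trans (+-congˡ (⊛-x* (tail f) g n)) (sym (⊛-tailˡ f g n))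

  ⊛-assoc : ∀ f g h → (f ⊛ g) ⊛ h ≈ˢ f ⊛ (g ⊛ h)
  ⊛-assoc f g h zero    = solve 3 (λ x y z → (x :* y :+ con (+ 0)) :* z :+ con (+ 0) := x :* (y :* z :+ con (+ 0)) :+ con (+ 0))
                                   refl (f 0) (g 0) (h 0)
  ⊛-assoc f g h (suc n) = begin
    (f ⊛ g) 0 * h (suc n) + ((f 0 ·ˢ tail g +ˢ tail f ⊛ g) ⊛ h) n
      ≈⟨ +-congˡ (⊛-distribʳ-+ˢ (f 0 ·ˢ tail g) (tail f ⊛ g) h n) ⟩
    (f ⊛ g) 0 * h (suc n) + (((f 0 ·ˢ tail g) ⊛ h) n + ((tail f ⊛ g) ⊛ h) n)
      ≈⟨ +-congˡ (+-cong (·ˢ-⊛ (f 0) (tail g) h n) (⊛-assoc (tail f) g h n)) ⟩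
    (f 0 * g 0 + 0#) * h (suc n) + (f 0 * (tail g ⊛ h) n + (tail f ⊛ (g ⊛ h)) n)
      ≈⟨ solve 5 (λ x y z p q → (x :* y :+ con (+ 0)) :* z :+ (x :* p :+ q) := x :* (y :* z :+ p) :+ q) refl _ _ _ _ _ ⟩
    f 0 * (g 0 * h (suc n) + (tail g ⊛ h) n) + (tail f ⊛ (g ⊛ h)) n
      ∎

  x^_∣_ : ℕ → Series F → Set ℓ
  x^ k ∣ f = ∀ {n} → n < k → f n ≈ 0#

  x^∣x* : ∀ {k f} → x^ k ∣ f → x^ suc k ∣ x* f
  x^∣x* x^k∣f {zero}  _         = refl
  x^∣x* x^k∣f {suc n} (s<s n<k) = x^k∣f n<k

  x^∣⊛ʳ : ∀ {k} f {g} → x^ k ∣ g → x^ k ∣ f ⊛ g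
  x^∣⊛ʳ f x^k∣g {zero}  0<k   = trans (+-identityʳ _) (trans (*-congˡ (x^k∣g 0<k)) (zeroʳ _))
  x^∣⊛ʳ f x^k∣g {suc n} n+1<k = trans (+-cong (trans (*-congˡ (x^k∣g n+1<k)) (zeroʳ _))
                                              (x^∣⊛ʳ (tail f) x^k∣g (ℕ.<⇒≤ n+1<k)))
                                      (+-identityʳ 0#)

  ⊛-leading : ∀ f {g n} → x^ n ∣ g → (f ⊛ g) n ≈ f 0 * g n
  ⊛-leading f {n = zero}  _      = +-identityʳ _
  ⊛-leading f {n = suc n} x^n∣g = trans (+-congˡ (x^∣⊛ʳ (tail f) x^n∣g (ℕ.n<1+n n))) (+-identityʳ _)

  jacobi : Carrier → Carrier → Series F → Series F
  jacobi α β y = x* y +ˢ (α ·ˢ y +ˢ β ·ˢ tail y)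

  jacobi-symmetric : ∀ α β n (y z : Series F) → y n ≈ 0# → y (suc n) ≈ 0# →
    ∑[ k < suc n ] (jacobi α β y (toℕ k) * (β ^ toℕ k * z (toℕ k))) ≈
    ∑[ k < suc n ] (y (toℕ k) * (β ^ toℕ k * jacobi α β z (toℕ k)))
  jacobi-symmetric α β n y z yₙ≈0 y₁₊ₙ≈0 = begin
    ∑[ k < suc n ] (jacobi α β y (toℕ k) * (β ^ toℕ k * z (toℕ k)))
      ≈⟨ sum-cong-≋ {suc n} (splitˡ ∘ toℕ) ⟩
    ∑[ k < suc n ] ((A (toℕ k) + B (toℕ k)) + α * C (toℕ k))
      ≈⟨ ∑-linear {suc n} (A ∘ toℕ) (B ∘ toℕ) (C ∘ toℕ) α ⟩
    (∑[ k < suc n ] A (toℕ k) + ∑[ k < suc n ] B (toℕ k)) + α * ∑[ k < suc n ] C (toℕ k)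
      ≈⟨ +-congʳ (+-cong ΣA≈ΣB′ (sym ΣA′≈ΣB)) ⟩
    (∑[ k < suc n ] B′ (toℕ k) + ∑[ k < suc n ] A′ (toℕ k)) + α * ∑[ k < suc n ] C (toℕ k)
      ≈⟨ +-congʳ (+-comm _ _) ⟩
    (∑[ k < suc n ] A′ (toℕ k) + ∑[ k < suc n ] B′ (toℕ k)) + α * ∑[ k < suc n ] C (toℕ k)
      ≈⟨ ∑-linear {suc n} (A′ ∘ toℕ) (B′ ∘ toℕ) (C ∘ toℕ) α ⟨
    ∑[ k < suc n ] ((A′ (toℕ k) + B′ (toℕ k)) + α * C (toℕ k))
      ≈⟨ sum-cong-≋ {suc n} (splitʳ ∘ toℕ) ⟨
    ∑[ k < suc n ] (y (toℕ k) * (β ^ toℕ k * jacobi α β z (toℕ k)))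
      ∎
    where
    A B C A′ B′ : ℕ → Carrier
    A  k = x* y k * (β ^ k * z k)
    B  k = (β * y (suc k)) * (β ^ k * z k)
    C  k = y k * (β ^ k * z k)
    A′ k = y k * (β ^ k * x* z k)
    B′ k = y k * (β ^ k * (β * z (suc k)))

    splitˡ : ∀ k → jacobi α β y k * (β ^ k * z k) ≈ (A k + B k) + α * C k
    splitˡ k = solve 6 (λ y⁻ α β y y⁺ w → (y⁻ :+ (α :* y :+ β :* y⁺)) :* w :=
                                          (y⁻ :* w :+ β :* y⁺ :* w) :+ α :* (y :* w))
                       refl (x* y k) α β (y k) (y (suc k)) (β ^ k * z k)

    splitʳ : ∀ k → y k * (β ^ k * jacobi α β z k) ≈ (A′ k + B′ k) + α * C k
    splitʳ k = solve 7 (λ y p z⁻ α β z z⁺ → y :* (p :* (z⁻ :+ (α :* z :+ β :* z⁺))) :=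
                                           (y :* (p :* z⁻) :+ y :* (p :* (β :* z⁺))) :+ α :* (y :* (p :* z)))
                       refl (y k) (β ^ k) (x* z k) α β (z k) (z (suc k))

    -- Shifting k by one matches A with B′ and A′ with B; the boundary terms vanish as y n ≈ y (1 + n) ≈ 0.
    ΣA≈ΣB′ : ∑[ k < suc n ] A (toℕ k) ≈ ∑[ k < suc n ] B′ (toℕ k)
    ΣA≈ΣB′ = sum-shift n A B′ (zeroˡ _) (trans (*-congʳ yₙ≈0) (zeroˡ _))
      (λ k → solve 4 (λ y β p z → y :* ((β :* p) :* z) := y :* (p :* (β :* z))) refl (y k) β (β ^ k) (z (suc k)))

    ΣA′≈ΣB : ∑[ k < suc n ] A′ (toℕ k) ≈ ∑[ k < suc n ] B (toℕ k)
    ΣA′≈ΣB = sum-shift n A′ B (trans (*-congˡ (zeroʳ _)) (zeroʳ _))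
      (trans (*-congʳ (trans (*-congˡ y₁₊ₙ≈0) (zeroʳ β))) (zeroˡ _))
      (λ k → solve 4 (λ y β p z → y :* ((β :* p) :* z) := (β :* y) :* (p :* z)) refl (y (suc k)) β (β ^ k) (z k))

module QuadraticSeries {c ℓ} (F : Field c ℓ) where
  open Field F
  open FieldProperties F
  open FiniteSums commutativeSemiring
  open PowerSeries F
  open LDLᵀ F
  open import Algebra.Properties.Semiring.Sum semiring using (sum-syntax; sum-cong-≋)
  open import Algebra.Properties.Semiring.Exp semiring using (_^_)
  open import Relation.Binary.Reasoning.Setoid setoid

  module _ (g : Series F) (α β : Carrier) (β≉0 : ¬ β ≈ 0#) (g₀≈1 : g 0 ≈ 1#)
           (g-recurrence : tail g ≈ˢ α ·ˢ g +ˢ β ·ˢ x* (g ⊛ g)) where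

    column : ℕ → Series F
    column zero    = g
    column (suc k) = x* (g ⊛ column k)

    row : ℕ → Series F
    row i k = column k i

    column-x^∣ : ∀ k → x^ k ∣ column k
    column-x^∣ zero    ()
    column-x^∣ (suc k) = x^∣x* (x^∣⊛ʳ g (column-x^∣ k))

    column-diagonal : ∀ k → column k k ≈ 1#
    column-diagonal zero    = g₀≈1
    column-diagonal (suc k) = begin
      (g ⊛ column k) k   ≈⟨ ⊛-leading g (column-x^∣ k) ⟩
      g 0 * column k k   ≈⟨ *-cong g₀≈1 (column-diagonal k) ⟩
      1# * 1#            ≈⟨ *-identityˡ 1# ⟩
      1#                 ∎

    tail-g-⊛ : ∀ h → tail g ⊛ h ≈ˢ α ·ˢ (g ⊛ h) +ˢ β ·ˢ (g ⊛ x* (g ⊛ h))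
    tail-g-⊛ h n = begin
      (tail g ⊛ h) n                                  ≈⟨ ⊛-cong {g = h} g-recurrence (λ _ → refl) n ⟩
      ((α ·ˢ g +ˢ β ·ˢ x* (g ⊛ g)) ⊛ h) n             ≈⟨ ⊛-distribʳ-+ˢ (α ·ˢ g) (β ·ˢ x* (g ⊛ g)) h n ⟩
      ((α ·ˢ g) ⊛ h) n + ((β ·ˢ x* (g ⊛ g)) ⊛ h) n    ≈⟨ +-cong (·ˢ-⊛ α g h n) (·ˢ-⊛ β (x* (g ⊛ g)) h n) ⟩
      α * (g ⊛ h) n + β * (x* (g ⊛ g) ⊛ h) n          ≈⟨ +-congˡ (*-congˡ (x*-⊛ (g ⊛ g) h n)) ⟩
      α * (g ⊛ h) n + β * x* ((g ⊛ g) ⊛ h) n          ≈⟨ +-congˡ (*-congˡ (x*-cong (⊛-assoc g g h) n)) ⟩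
      α * (g ⊛ h) n + β * x* (g ⊛ (g ⊛ h)) n          ≈⟨ +-congˡ (*-congˡ (⊛-x* g (g ⊛ h) n)) ⟨
      α * (g ⊛ h) n + β * (g ⊛ x* (g ⊛ h)) n          ∎

    row-recurrence : ∀ i → row (suc i) ≈ˢ jacobi α β (row i)
    row-recurrence i zero    = trans (g-recurrence i) (sym (+-identityˡ _))
    row-recurrence i (suc k) = begin
      (g ⊛ column k) i
        ≈⟨ ⊛-tailˡ g (column k) i ⟩
      g 0 * column k i + x* (tail g ⊛ column k) i
        ≈⟨ +-cong (trans (*-congʳ g₀≈1) (*-identityˡ _)) (x*-cong (tail-g-⊛ (column k)) i) ⟩
      column k i + x* (α ·ˢ (g ⊛ column k) +ˢ β ·ˢ (g ⊛ column (suc k))) i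
        ≈⟨ +-congˡ (x*-+ˢ (α ·ˢ (g ⊛ column k)) (β ·ˢ (g ⊛ column (suc k))) i) ⟩
      column k i + (x* (α ·ˢ (g ⊛ column k)) i + x* (β ·ˢ (g ⊛ column (suc k))) i)
        ≈⟨ +-congˡ (+-cong (x*-·ˢ α (g ⊛ column k) i) (x*-·ˢ β (g ⊛ column (suc k)) i)) ⟩
      column k i + (α * column (suc k) i + β * column (suc (suc k)) i)
        ∎

    innerProduct : ℕ → ℕ → ℕ → Carrier
    innerProduct N i j = ∑[ k < N ] (row i (toℕ k) * (β ^ toℕ k * row j (toℕ k)))

    innerProduct-shift : ∀ {N i} j → suc i < N → innerProduct N (suc i) j ≈ innerProduct N i (suc j)
    innerProduct-shift {suc n} {i} j (s<s i<n) = begin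
      ∑[ k < suc n ] (row (suc i) (toℕ k) * (β ^ toℕ k * row j (toℕ k)))
        ≈⟨ sum-cong-≋ {suc n} (recurˡ ∘ toℕ) ⟩
      ∑[ k < suc n ] (jacobi α β (row i) (toℕ k) * (β ^ toℕ k * row j (toℕ k)))
        ≈⟨ jacobi-symmetric α β n (row i) (row j) (column-x^∣ n i<n) (column-x^∣ (suc n) (ℕ.m<n⇒m<1+n i<n)) ⟩
      ∑[ k < suc n ] (row i (toℕ k) * (β ^ toℕ k * jacobi α β (row j) (toℕ k)))
        ≈⟨ sum-cong-≋ {suc n} (recurʳ ∘ toℕ) ⟨
      ∑[ k < suc n ] (row i (toℕ k) * (β ^ toℕ k * row (suc j) (toℕ k)))
        ∎
      where
      recurˡ : ∀ k → row (suc i) k * (β ^ k * row j k) ≈ jacobi α β (row i) k * (β ^ k * row j k)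
      recurˡ k = *-congʳ (row-recurrence i k)

      recurʳ : ∀ k → row i k * (β ^ k * row (suc j) k) ≈ row i k * (β ^ k * jacobi α β (row j) k)
      recurʳ k = *-congˡ (*-congˡ (row-recurrence j k))

    innerProduct-base : ∀ n j → innerProduct (suc n) 0 j ≈ g j
    innerProduct-base n j = begin
      innerProduct (suc n) 0 j   ≈⟨ sum-single {suc n} (λ k → row 0 (toℕ k) * (β ^ toℕ k * row j (toℕ k)))
                                                 Fin.zero vanishes ⟩
      g 0 * (1# * g j)           ≈⟨ *-cong g₀≈1 (*-identityˡ _) ⟩
      1# * g j                   ≈⟨ *-identityˡ _ ⟩
      g j                        ∎
      where
      vanishes : ∀ k → k ≢ Fin.zero → row 0 (toℕ k) * (β ^ toℕ k * row j (toℕ k)) ≈ 0#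
      vanishes Fin.zero    k≢0 = contradiction ≡.refl k≢0
      vanishes (Fin.suc k) _   = zeroˡ _

    innerProduct≈g : ∀ {N} i j → i < N → innerProduct N i j ≈ g (i ℕ.+ j)
    innerProduct≈g {suc n} zero    j _     = innerProduct-base n j
    innerProduct≈g {N}     (suc i) j 1+i<N = begin
      innerProduct N (suc i) j   ≈⟨ innerProduct-shift j 1+i<N ⟩
      innerProduct N i (suc j)   ≈⟨ innerProduct≈g i (suc j) (ℕ.<⇒≤ 1+i<N) ⟩
      g (i ℕ.+ suc j)            ≡⟨ ≡.cong g (ℕ.+-suc i j) ⟩
      g (suc i ℕ.+ j)            ∎

    hankel-fullRank : ∀ d → FullRank F (suc d) (hankel F d g)
    hankel-fullRank d = LDLᵀ-fullRank (hankel F d g) L (λ k → β ^ toℕ k)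
      (column-diagonal ∘ toℕ) (column-x^∣ _) (^-≉0 β≉0 ∘ toℕ)
      (λ i j → sym (innerProduct≈g (toℕ i) (toℕ j) (Fin.toℕ<n i)))
      where
      L : Fin (suc d) → Fin (suc d) → Carrier
      L i k = column (toℕ k) (toℕ i)

module GeneratingFunction {a ℓ} (F : Field a ℓ) (charZero : CharZero F) (b c : Field.Carrier F)
                          (b≉c : ¬ Field._≈_ F b c) (s : Series F) (sqrt : IsSqrtP F b c s) where
  open Field F
  open FieldProperties F
  open IntegerCoefficients commutativeRing
  open PowerSeries F
  open import Algebra.Properties.Group +-group using (x∙y⁻¹≈ε⇒x≈y; inverseʳ-unique)
  open import Relation.Binary.Reasoning.Setoid setoid

  private
    s₀≈1 : s 0 ≈ 1#
    s₀≈1 = proj₁ sqrt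

    s²≈P : s ⊛ s ≈ˢ Defs.P F b c
    s²≈P = proj₂ sqrt

  σ : Series F
  σ = tail (tail s)

  square₁ : (s ⊛ s) 1 ≈ s 1 + s 1
  square₁ = begin
    s 0 * s 1 + (s 1 * s 0 + 0#)   ≈⟨ +-cong (*-congʳ s₀≈1) (+-congʳ (*-congˡ s₀≈1)) ⟩
    1# * s 1 + (s 1 * 1# + 0#)     ≈⟨ solve 1 (λ t → con (+ 1) :* t :+ (t :* con (+ 1) :+ con (+ 0)) := t :+ t) refl (s 1) ⟩
    s 1 + s 1                      ∎

  square₂ : (s ⊛ s) 2 ≈ (σ 0 + σ 0) + s 1 * s 1
  square₂ = begin
    s 0 * σ 0 + (s 1 * s 1 + (σ 0 * s 0 + 0#))   ≈⟨ +-cong (*-congʳ s₀≈1) (+-congˡ (+-congʳ (*-congˡ s₀≈1))) ⟩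
    1# * σ 0 + (s 1 * s 1 + (σ 0 * 1# + 0#))     ≈⟨ solve 2 (λ t u → con (+ 1) :* u :+ (t :* t :+ (u :* con (+ 1) :+ con (+ 0)))
                                                                     := (u :+ u) :+ t :* t) refl (s 1) (σ 0) ⟩
    (σ 0 + σ 0) + s 1 * s 1                       ∎

  square₃₊ : ∀ n → (s ⊛ s) (3 ℕ.+ n) ≈ (σ (suc n) + σ (suc n)) + ((s 1 * σ n + s 1 * σ n) + x* (σ ⊛ σ) n)
  square₃₊ n = begin
    s 0 * σ (suc n) + (s 1 * σ n + (σ ⊛ s) (suc n))
      ≈⟨ +-congˡ (+-congˡ (⊛-tailʳ σ s (suc n))) ⟩
    s 0 * σ (suc n) + (s 1 * σ n + (s 0 * σ (suc n) + (σ ⊛ tail s) n))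
      ≈⟨ +-congˡ (+-congˡ (+-congˡ (⊛-tailʳ σ (tail s) n))) ⟩
    s 0 * σ (suc n) + (s 1 * σ n + (s 0 * σ (suc n) + (s 1 * σ n + x* (σ ⊛ σ) n)))
      ≈⟨ +-cong (*-congʳ s₀≈1) (+-congˡ (+-congʳ (*-congʳ s₀≈1))) ⟩
    1# * σ (suc n) + (s 1 * σ n + (1# * σ (suc n) + (s 1 * σ n + x* (σ ⊛ σ) n)))
      ≈⟨ solve 3 (λ u v w → con (+ 1) :* u :+ (v :+ (con (+ 1) :* u :+ (v :+ w))) := (u :+ u) :+ ((v :+ v) :+ w))
               refl (σ (suc n)) (s 1 * σ n) (x* (σ ⊛ σ) n) ⟩
    (σ (suc n) + σ (suc n)) + ((s 1 * σ n + s 1 * σ n) + x* (σ ⊛ σ) n)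
      ∎

  e κ : Carrier
  e = (b - c) * (b - c)
  κ = Defs.fromℕ F 8 * e ⁻¹

  g : Series F
  g = G F b c s

  α β : Carrier
  α = - s 1
  β = (κ + κ) ⁻¹

  e≉0 : ¬ e ≈ 0#
  e≉0 = *-≉0 b-c≉0 b-c≉0
    where
    b-c≉0 : ¬ b - c ≈ 0#
    b-c≉0 = b≉c ∘ x∙y⁻¹≈ε⇒x≈y b c

  κ+κ≉0 : ¬ κ + κ ≈ 0#
  κ+κ≉0 κ+κ≈0 = *-≉0 (charZero 1) (*-≉0 (charZero 7) (⁻¹-≉0 e≉0)) (begin
    Defs.fromℕ F 2 * κ   ≈⟨ solve 1 (λ k → lit 2 :* k := k :+ k) refl κ ⟩
    κ + κ                ≈⟨ κ+κ≈0 ⟩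
    0#                   ∎)

  eight-σ₀ : Defs.fromℕ F 8 * (- σ 0) ≈ e
  eight-σ₀ = begin
    Defs.fromℕ F 8 * (- σ 0)
      ≈⟨ solve 2 (λ t u → lit 8 :* (:- u) := (t :+ t) :* (t :+ t) :- lit 4 :* ((u :+ u) :+ t :* t)) refl (s 1) (σ 0) ⟩
    (s 1 + s 1) * (s 1 + s 1) - Defs.fromℕ F 4 * ((σ 0 + σ 0) + s 1 * s 1)
      ≈⟨ +-cong (*-cong two-s₁ two-s₁) (-‿cong (*-congˡ two-σ₀)) ⟩
    (- (b + c)) * (- (b + c)) - Defs.fromℕ F 4 * (b * c)
      ≈⟨ solve 2 (λ b c → (:- (b :+ c)) :* (:- (b :+ c)) :- lit 4 :* (b :* c) := (b :- c) :* (b :- c)) refl b c ⟩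
    e ∎
    where
    two-s₁ : s 1 + s 1 ≈ - (b + c)
    two-s₁ = trans (sym square₁) (s²≈P 1)
    two-σ₀ : (σ 0 + σ 0) + s 1 * s 1 ≈ b * c
    two-σ₀ = trans (sym square₂) (s²≈P 2)

  g₀≈1 : g 0 ≈ 1#
  g₀≈1 = begin
    (Defs.fromℕ F 8 * e ⁻¹) * (- σ 0)   ≈⟨ solve 3 (λ x y z → (x :* y) :* z := y :* (x :* z)) refl _ _ _ ⟩
    e ⁻¹ * (Defs.fromℕ F 8 * (- σ 0))   ≈⟨ *-congˡ eight-σ₀ ⟩
    e ⁻¹ * e                            ≈⟨ ⁻¹-inverseˡ e≉0 ⟩
    1#                                  ∎

  x*[g⊛g]≈κ²x*[σ⊛σ] : ∀ n → x* (g ⊛ g) n ≈ (κ * κ) * x* (σ ⊛ σ) n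
  x*[g⊛g]≈κ²x*[σ⊛σ] n = trans (x*-cong g⊛g≈κ²σ⊛σ n) (x*-·ˢ (κ * κ) (σ ⊛ σ) n)
    where
    g≈-κσ : g ≈ˢ (- κ) ·ˢ σ
    g≈-κσ k = solve 2 (λ k u → k :* (:- u) := (:- k) :* u) refl κ (σ k)
    g⊛g≈κ²σ⊛σ : g ⊛ g ≈ˢ (κ * κ) ·ˢ (σ ⊛ σ)
    g⊛g≈κ²σ⊛σ k = begin
      (g ⊛ g) k                            ≈⟨ ⊛-cong g≈-κσ g≈-κσ k ⟩
      (((- κ) ·ˢ σ) ⊛ ((- κ) ·ˢ σ)) k      ≈⟨ ·ˢ-⊛ (- κ) σ ((- κ) ·ˢ σ) k ⟩
      (- κ) * (σ ⊛ ((- κ) ·ˢ σ)) k         ≈⟨ *-congˡ (⊛-·ˢ (- κ) σ σ k) ⟩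
      (- κ) * ((- κ) * (σ ⊛ σ) k)          ≈⟨ solve 2 (λ k p → (:- k) :* ((:- k) :* p) := (k :* k) :* p) refl κ _ ⟩
      (κ * κ) * (σ ⊛ σ) k                  ∎

  twice-κ-recurrence : ∀ n → (κ + κ) * g (suc n) ≈ (κ + κ) * (α * g n) + x* (g ⊛ g) n
  twice-κ-recurrence n = begin
    (κ + κ) * (κ * (- σ (suc n)))
      ≈⟨ solve 2 (λ k u → (k :+ k) :* (k :* (:- u)) := (k :* k) :* (:- (u :+ u))) refl κ (σ (suc n)) ⟩
    (κ * κ) * (- (σ (suc n) + σ (suc n)))
      ≈⟨ *-congˡ σ-recurrence ⟨
    (κ * κ) * ((s 1 * σ n + s 1 * σ n) + x* (σ ⊛ σ) n)
      ≈⟨ solve 4 (λ k t u w → (k :* k) :* ((t :* u :+ t :* u) :+ w) :=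
                              (k :+ k) :* ((:- t) :* (k :* (:- u))) :+ (k :* k) :* w)
               refl κ (s 1) (σ n) (x* (σ ⊛ σ) n) ⟩
    (κ + κ) * (α * g n) + (κ * κ) * x* (σ ⊛ σ) n
      ≈⟨ +-congˡ (x*[g⊛g]≈κ²x*[σ⊛σ] n) ⟨
    (κ + κ) * (α * g n) + x* (g ⊛ g) n
      ∎
    where
    σ-recurrence : (s 1 * σ n + s 1 * σ n) + x* (σ ⊛ σ) n ≈ - (σ (suc n) + σ (suc n))
    σ-recurrence = inverseʳ-unique _ _ (trans (sym (square₃₊ n)) (s²≈P (3 ℕ.+ n)))

  g-recurrence : tail g ≈ˢ α ·ˢ g +ˢ β ·ˢ x* (g ⊛ g)
  g-recurrence n = q*x≈q*y+z⇒x≈y+q⁻¹*z κ+κ≉0 (twice-κ-recurrence n)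

  β≉0 : ¬ β ≈ 0#
  β≉0 = ⁻¹-≉0 κ+κ≉0

lemma4p4 : ∀ {c ℓ} (F : Field c ℓ) → CharZero F →
    (b c' : Field.Carrier F) →
    ¬ (Field._≈_ F b (Field.0# F)) → ¬ (Field._≈_ F c' (Field.0# F)) → ¬ (Field._≈_ F b c') →
    (s : Series F) → IsSqrtP F b c' s →
    (d : ℕ) → FullRank F (suc d) (hankel F d (G F b c' s))
lemma4p4 F charZero b c' _ _ b≉c' s sqrt =
  QuadraticSeries.hankel-fullRank F g α β β≉0 g₀≈1 g-recurrence
  where
  open GeneratingFunction F charZero b c' b≉c' s sqrt
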